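{- Let $m\ge1$, let $w_1\ge w_2\ge\dots\ge w_m$ be positive integers, let $y$ be a positive integer with $w_m<y$, and let $u$ be a positive integer with $u\le y$. Let $u^\bullet\in\{u',u\}$, and for each index $r$ let $w_r^\bullet\in\{w_r',w_r\}$ have the same prime status as $u^\bullet$ (i.e. $u-u^\bullet=w_r-w_r^\bullet$), while $w_r^\circ\in\{w_r',w_r\}$ all share a common, arbitrary prime status. Then: (i) If $u>w_m$ and $w_1<y$, then $u^\bullet\,y\,w_m^\circ w_{m-1}\cdots w_1\overset{\mathrm{dec}}\sim u\,w_m^\circ w_{m-1}\cdots w_2\,y\,w_1^\bullet$. (ii) If $u\le w_m$ and $w_1<y$, then $u^\bullet\,y\,w_m^\circ w_{m-1}\cdots w_1\overset{\mathrm{dec}}\sim u^\bullet w_mw_{m-1}\cdots w_2\,y\,w_1^\circ$. (iii) If $u>w_m$ and $w_j<y\le w_{j-1}$ for some $2\le j<m$, then $u^\bullet\,y\,w_m^\circ w_{m-1}\cdots w_1\overset{\mathrm{dec}}\sim u\,w_m^\circ w_{m-1}\cdots w_{j+1}\,y\,w_{j-1}\cdots w_1\,w_j^\bullet$. (iv) If $u\le w_m$ and $w_j<y\le w_{j-1}$ for some $2\le j<m$, then $u^\bullet\,y\,w_m^\circ w_{m-1}\cdots w_1\overset{\mathrm{dec}}\sim u^\bullet w_mw_{m-1}\cdots w_{j+1}\,y\,w_{j-1}\cdots w_1\,w_j^\circ$. (v) If $w_m<y\le w_{m-1}$, then $u^\bullet\,y\,w_m^\circ w_{m-1}\cdots w_1\overset{\mathrm{dec}}\sim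 u^\bullet\,y\,w_{m-1}w_{m-2}\cdots w_1\,w_m^\circ$.
   Context: Primed numbers: for an integer $i$, $i':=i-\tfrac12$; a primed word is a finite sequence of elements of $\{1'<1<2'<2<\cdots\}$; unannotated letters in words are unprimed. The relation $\overset{\mathrm{dec}}\sim$ is the smallest equivalence relation on primed words such that $a\sim u$, $b\sim v$ imply $ab\sim uv$ and which contains, for all unprimed positive integers $a,b,c,d$ and all $a^\bullet,a^\circ\in\{a',a\}$, $b^\bullet,b^\circ\in\{b',b\}$, $c^\bullet,c^\circ\in\{c',c\}$ with $a-a^\bullet=b-b^\bullet=c-c^\bullet$ and $a-a^\circ=b-b^\circ=c-c^\circ$: (1) $a^\bullet b\sim a^\bullet b'$ if $a\le b$; (2) $b a^\bullet\sim b'a^\bullet$ if $a<b$; (3) $a^\bullet b d c^\circ\sim a^\bullet d b^\circ c$ if $a\le b\le c<d$; (4) $a^\bullet c d b^\circ\sim a^\bullet c b^\circ d$ if $a\le b<c\le d$; (5) $d a^\bullet c b^\circ\sim a^\bullet d c b^\circ$ if $a\le b<c<d$; (6) $b a^\bullet d c^\circ\sim b^\circ d a^\bullet c$ if $a<b\le c<d$; (7) $c b^\bullet d a^\circ\sim c^\bullet d b a^\circ$ if $a<b<c\le d$; (8) $d b^\bullet c a^\circ\sim b^\bullet d c a^\circ$ if $a<b\le c<d$; (9) $b^\bullet c d a^\circ\sim b^\bullet c a^\circ d$ if $a<b\le c\le d$; (10) $c a^\bullet d b^\circ\sim c^\circ d a^\bullet b$ if $a\le b<c\le d$. -}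

module Defs where

open import Data.Nat using (ℕ; zero; suc; _≤_; _<_; _≤ᵇ_)
open import Data.Bool using (Bool; true; false; if_then_else_)
open import Data.Product using (_×_; _,_)
open import Data.List using (List; []; _∷_; _++_)

-- A primed letter (n , false) is the unprimed integer n,
-- (n , true) is the primed number n' = n - 1/2.
Letter : Set
Letter = ℕ × Bool

Word : Set
Word = List Letter

un : ℕ → Letter
un n = n , false

-- A bullet (resp. circle) prime status is a
-- Bool p (resp. q) shared by all bulleted (resp. circled) letters, which encodes
-- a - a• = b - b• = c - c• (resp. for ∘).  a,b,c,d are positive (1 ≤ a suffices
-- since a is the smallest in each rule).
data Gen : Word → Word → Set where
  rel1  : ∀ {a b} (p : Bool) → 1 ≤ a → a ≤ b →
          Gen ((a , p) ∷ un b ∷ []) ((a , p) ∷ (b , true) ∷ [])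
  rel2  : ∀ {a b} (p : Bool) → 1 ≤ a → a < b →
          Gen (un b ∷ (a , p) ∷ []) ((b , true) ∷ (a , p) ∷ [])
  rel3  : ∀ {a b c d} (p q : Bool) → 1 ≤ a → a ≤ b → b ≤ c → c < d →
          Gen ((a , p) ∷ un b ∷ un d ∷ (c , q) ∷ []) ((a , p) ∷ un d ∷ (b , q) ∷ un c ∷ [])
  rel4  : ∀ {a b c d} (p q : Bool) → 1 ≤ a → a ≤ b → b < c → c ≤ d →
          Gen ((a , p) ∷ un c ∷ un d ∷ (b , q) ∷ []) ((a , p) ∷ un c ∷ (b , q) ∷ un d ∷ [])
  rel5  : ∀ {a b c d} (p q : Bool) → 1 ≤ a → a ≤ b → b < c → c < d →
          Gen (un d ∷ (a , p) ∷ un c ∷ (b , q) ∷ []) ((a , p) ∷ un d ∷ un c ∷ (b , q) ∷ [])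
  rel6  : ∀ {a b c d} (p q : Bool) → 1 ≤ a → a < b → b ≤ c → c < d →
          Gen (un b ∷ (a , p) ∷ un d ∷ (c , q) ∷ []) ((b , q) ∷ un d ∷ (a , p) ∷ un c ∷ [])
  rel7  : ∀ {a b c d} (p q : Bool) → 1 ≤ a → a < b → b < c → c ≤ d →
          Gen (un c ∷ (b , p) ∷ un d ∷ (a , q) ∷ []) ((c , p) ∷ un d ∷ un b ∷ (a , q) ∷ [])
  rel8  : ∀ {a b c d} (p q : Bool) → 1 ≤ a → a < b → b ≤ c → c < d →
          Gen (un d ∷ (b , p) ∷ un c ∷ (a , q) ∷ []) ((b , p) ∷ un d ∷ un c ∷ (a , q) ∷ [])
  rel9  : ∀ {a b c d} (p q : Bool) → 1 ≤ a → a < b → b ≤ c → c ≤ d →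
          Gen ((b , p) ∷ un c ∷ un d ∷ (a , q) ∷ []) ((b , p) ∷ un c ∷ (a , q) ∷ un d ∷ [])
  rel10 : ∀ {a b c d} (p q : Bool) → 1 ≤ a → a ≤ b → b < c → c ≤ d →
          Gen (un c ∷ (a , p) ∷ un d ∷ (b , q) ∷ []) ((c , q) ∷ un d ∷ (a , p) ∷ un b ∷ [])

infix 4 _∼dec_
data _∼dec_ : Word → Word → Set where
  gen   : ∀ {x y} → Gen x y → x ∼dec y
  ∼refl  : ∀ {x} → x ∼dec x
  ∼sym   : ∀ {x y} → x ∼dec y → y ∼dec x
  ∼trans : ∀ {x y z} → x ∼dec y → y ∼dec z → x ∼dec z
  ∼cat   : ∀ {a b u v} → a ∼dec u → b ∼dec v → (a ++ b) ∼dec (u ++ v)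

-- seg w lo hi = w_hi w_(hi-1) ... w_lo (all unprimed); empty if hi < lo.
seg : (ℕ → ℕ) → ℕ → ℕ → Word
seg w lo zero = []
seg w lo (suc h) = if lo ≤ᵇ suc h then un (w (suc h)) ∷ seg w lo h else []

{-# OPTIONS --safe #-}
-- Relation (3), read right to left, moves y one step to the right and hands
-- the prime on: a y b^r c ∼ a b y c^r for a ≤ b ≤ c < y.  Iterating it walks y
-- through the weakly increasing run w_m ⋯ w_{j+1} until it stands before its
-- slot w_j < y ≤ w_{j-1}.  Relations (4) and (9) move a small letter s right:
-- x c s d ∼ x c d s for s < c ≤ d, x ≤ c, and this carries w_j past
-- y w_{j-1} ⋯ w_1 to the end.  In (i) and (iii) relation (6) or (10) first
-- turns u^• y w_m^∘ w_{m-1} into u w_m^∘ y w_{m-1}^•; (i) and (ii) are the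
-- case j = 1 of (iii) and (iv), and (v) is the carrying step alone.
module Submission where

open import Defs
open import Data.Nat using (ℕ; zero; suc; _≤_; _<_; _∸_; z≤n; s≤s; _≤?_)
open import Data.Nat.Properties
open import Data.Bool using (Bool)
open import Data.Product using (_×_; _,_)
open import Data.Sum using (inj₁; inj₂)
open import Data.List using ([]; _∷_; _++_)
open import Relation.Binary.PropositionalEquality using (_≡_; refl; cong)
open import Relation.Nullary using (yes; no)
open import Relation.Nullary.Decidable using (dec-true; dec-false)

AntitoneOn : (ℕ → ℕ) → ℕ → ℕ → Set
AntitoneOn w lo hi = ∀ r → lo ≤ r → r < hi → w (suc r) ≤ w r

module _ (w : ℕ → ℕ) where

  AntitoneOn-restrict : ∀ {lo hi lo′ hi′} → AntitoneOn w lo hi → lo ≤ lo′ → hi′ ≤ hi →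
                        AntitoneOn w lo′ hi′
  AntitoneOn-restrict mono lo≤lo′ hi′≤hi r lo′≤r r<hi′ =
    mono r (≤-trans lo≤lo′ lo′≤r) (<-≤-trans r<hi′ hi′≤hi)

  AntitoneOn⇒≤ : ∀ {lo hi i k} → AntitoneOn w lo hi → lo ≤ i → i ≤ k → k ≤ hi → w k ≤ w i
  AntitoneOn⇒≤ {k = zero} _ _ z≤n _ = ≤-refl
  AntitoneOn⇒≤ {k = suc k} mono lo≤i i≤k k<hi with m≤n⇒m<n∨m≡n i≤k
  ... | inj₂ refl = ≤-refl
  ... | inj₁ (s≤s i≤k′) =
    ≤-trans (mono k (≤-trans lo≤i i≤k′) k<hi) (AntitoneOn⇒≤ mono lo≤i i≤k′ (<⇒≤ k<hi))

  seg-empty : ∀ {lo} h → h < lo → seg w lo h ≡ []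
  seg-empty zero _ = refl
  seg-empty {lo} (suc h) h<lo rewrite dec-false (lo ≤? suc h) (<⇒≱ h<lo) = refl

  seg-suc : ∀ {lo} h → lo ≤ suc h → seg w lo (suc h) ≡ un (w (suc h)) ∷ seg w lo h
  seg-suc {lo} h lo≤ rewrite dec-true (lo ≤? suc h) lo≤ = refl

  seg-split : ∀ {lo l} h → lo ≤ suc l → l ≤ h → seg w lo h ≡ seg w (suc l) h ++ seg w lo l
  seg-split h lo≤ l≤h with m≤n⇒m<n∨m≡n l≤h
  ... | inj₂ refl rewrite seg-empty h (n<1+n h) = refl
  ... | inj₁ (s≤s {n = h′} l≤h′)
    rewrite seg-suc h′ (≤-trans lo≤ (s≤s l≤h′)) | seg-suc h′ (s≤s l≤h′) =
      cong (un (w (suc h′)) ∷_) (seg-split h′ lo≤ l≤h′)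

  sink-step : ∀ {x p c s q d} → 1 ≤ x → x ≤ c → 1 ≤ s → s < c → c ≤ d →
              (x , p) ∷ un c ∷ (s , q) ∷ un d ∷ [] ∼dec (x , p) ∷ un c ∷ un d ∷ (s , q) ∷ []
  sink-step {x} {p} {s = s} {q} 1≤x x≤c 1≤s s<c c≤d with x ≤? s
  ... | yes x≤s = ∼sym (gen (rel4 p q 1≤x x≤s s<c c≤d))
  ... | no x≰s = ∼sym (gen (rel9 p q 1≤s (≰⇒> x≰s) x≤c c≤d))

  sink : ∀ h {x p c s q} → 1 ≤ x → x ≤ c → 1 ≤ s → s < c →
         (1 ≤ h → c ≤ w h) → AntitoneOn w 1 h →
         (x , p) ∷ un c ∷ (s , q) ∷ seg w 1 h ∼dec (x , p) ∷ un c ∷ seg w 1 h ++ (s , q) ∷ []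
  sink zero _ _ _ _ _ _ = ∼refl
  sink (suc h) {x} {p} {c} 1≤x x≤c 1≤s s<c c≤w mono =
    ∼trans (∼cat {b = seg w 1 h} (sink-step 1≤x x≤c 1≤s s<c c≤d) ∼refl)
           (∼cat {a = (x , p) ∷ []} ∼refl
                 (sink h (≤-trans 1≤x x≤c) c≤d 1≤s (<-≤-trans s<c c≤d)
                       (λ 1≤h → mono h 1≤h ≤-refl)
                       (AntitoneOn-restrict mono ≤-refl (n≤1+n h))))
    where
      c≤d : c ≤ w (suc h)
      c≤d = c≤w (s≤s z≤n)

  -- The letter left of y when it reaches w (suc l) is not known syntactically
  -- (it is w (l + 2), or a if l = h), hence the continuation quantified over it.
  pass : ∀ {l} h {y r Z T} → l ≤ h → AntitoneOn w (suc l) (suc h) → w (suc l) < y →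
         (∀ {x p} → 1 ≤ x → x ≤ w (suc l) →
            (x , p) ∷ un y ∷ (w (suc l) , r) ∷ Z ∼dec (x , p) ∷ T) →
         ∀ {a p} → 1 ≤ a → a ≤ w (suc h) →
         (a , p) ∷ un y ∷ (w (suc h) , r) ∷ seg w (suc l) h ++ Z
           ∼dec (a , p) ∷ seg w (suc (suc l)) (suc h) ++ T
  pass h l≤h mono wl<y finish 1≤a a≤ with m≤n⇒m<n∨m≡n l≤h
  ... | inj₂ refl
    rewrite seg-empty h (n<1+n h) | seg-empty (suc h) (n<1+n (suc h)) = finish 1≤a a≤
  pass (suc h) {y} {r} {Z} _ mono wl<y finish {a} {p} 1≤a a≤ | inj₁ (s≤s l≤h)
    rewrite seg-suc h (s≤s l≤h) | seg-suc (suc h) (s≤s (s≤s l≤h)) =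
      ∼trans (∼cat {b = seg w _ h ++ Z} (∼sym (gen (rel3 p r 1≤a a≤ b≤c c<y))) ∼refl)
             (∼cat {a = (a , p) ∷ []} ∼refl
                   (pass h l≤h (AntitoneOn-restrict mono ≤-refl (n≤1+n _)) wl<y finish
                         (≤-trans 1≤a a≤) b≤c))
    where
      b≤c : w (suc (suc h)) ≤ w (suc h)
      b≤c = mono (suc h) (s≤s l≤h) ≤-refl
      c<y : w (suc h) < y
      c<y = ≤-<-trans (AntitoneOn⇒≤ mono ≤-refl (s≤s l≤h) (n≤1+n _)) wl<y

  settle : ∀ m j {y r} → 1 ≤ j → j ≤ m → AntitoneOn w 1 m → w j < y →
           (2 ≤ j → y ≤ w (j ∸ 1)) →
           ∀ {a p} → 1 ≤ a → a ≤ w m →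
           (a , p) ∷ un y ∷ (w m , r) ∷ seg w 1 (m ∸ 1)
             ∼dec (a , p) ∷ seg w (suc j) m ++ un y ∷ seg w 1 (j ∸ 1) ++ (w j , r) ∷ []
  settle (suc h) (suc l) {y} {r} _ (s≤s l≤h) mono wj<y y≤ 1≤a a≤
    rewrite seg-split h (s≤s z≤n) l≤h =
      pass h l≤h (AntitoneOn-restrict mono (s≤s z≤n) ≤-refl) wj<y finish 1≤a a≤
    where
      1≤wj : 1 ≤ w (suc l)
      1≤wj = ≤-trans 1≤a (≤-trans a≤ (AntitoneOn⇒≤ mono (s≤s z≤n) (s≤s l≤h) ≤-refl))
      finish : ∀ {x p} → 1 ≤ x → x ≤ w (suc l) →
               (x , p) ∷ un y ∷ (w (suc l) , r) ∷ seg w 1 l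
                 ∼dec (x , p) ∷ un y ∷ seg w 1 l ++ (w (suc l) , r) ∷ []
      finish 1≤x x≤wj =
        sink l 1≤x (<⇒≤ (≤-<-trans x≤wj wj<y)) 1≤wj wj<y (λ 1≤l → y≤ (s≤s 1≤l))
             (AntitoneOn-restrict mono ≤-refl (≤-trans (n≤1+n l) (s≤s l≤h)))

  lead-swap : ∀ {u p b q c y} → 1 ≤ b → b < u → b ≤ c → c < y → u ≤ y →
              (u , p) ∷ un y ∷ (b , q) ∷ un c ∷ [] ∼dec un u ∷ (b , q) ∷ un y ∷ (c , p) ∷ []
  lead-swap {u} {p} {q = q} {c} 1≤b b<u b≤c c<y u≤y with u ≤? c
  ... | yes u≤c = ∼sym (gen (rel6 q p 1≤b b<u u≤c c<y))
  ... | no u≰c = ∼sym (gen (rel10 q p 1≤b b≤c (≰⇒> u≰c) u≤y))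

  swap-settle : ∀ m j {y u p q} → 1 ≤ j → j < m → AntitoneOn w 1 m →
                1 ≤ w m → w m < u → u ≤ y → w j < y → (2 ≤ j → y ≤ w (j ∸ 1)) →
                (u , p) ∷ un y ∷ (w m , q) ∷ seg w 1 (m ∸ 1)
                  ∼dec un u ∷ (w m , q) ∷ seg w (suc j) (m ∸ 1)
                         ++ un y ∷ seg w 1 (j ∸ 1) ++ (w j , p) ∷ []
  swap-settle (suc zero) _ (s≤s _) (s≤s ())
  swap-settle (suc (suc n)) j {y} {u} {p} {q} 1≤j (s≤s j≤n) mono 1≤wm wm<u u≤y wj<y y≤ =
    ∼trans (∼cat {b = seg w 1 n} (lead-swap 1≤wm wm<u wm≤wn wn<y u≤y) ∼refl)
           (∼cat {a = un u ∷ []} ∼refl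
                 (settle (suc n) j 1≤j j≤n (AntitoneOn-restrict mono ≤-refl (n≤1+n _))
                         wj<y y≤ 1≤wm wm≤wn))
    where
      wm≤wn : w (suc (suc n)) ≤ w (suc n)
      wm≤wn = mono (suc n) (s≤s z≤n) ≤-refl
      wn<y : w (suc n) < y
      wn<y = ≤-<-trans (AntitoneOn⇒≤ mono 1≤j j≤n (n≤1+n _)) wj<y

mainTheorem16 : (m : ℕ) (w : ℕ → ℕ) (y u : ℕ) (p q : Bool) →
    1 ≤ m →
    (∀ r → 1 ≤ r → r < m → w (suc r) ≤ w r) →
    (∀ r → 1 ≤ r → r ≤ m → 1 ≤ w r) →
    1 ≤ y → w m < y → 1 ≤ u → u ≤ y →
    -- (i)
    (2 ≤ m → w m < u → w 1 < y →
      ((u , p) ∷ un y ∷ (w m , q) ∷ seg w 1 (m ∸ 1))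
        ∼dec ((un u ∷ (w m , q) ∷ seg w 2 (m ∸ 1)) ++ (un y ∷ (w 1 , p) ∷ [])))
    ×
    -- (ii)
    (2 ≤ m → u ≤ w m → w 1 < y →
      ((u , p) ∷ un y ∷ (w m , q) ∷ seg w 1 (m ∸ 1))
        ∼dec (((u , p) ∷ seg w 2 m) ++ (un y ∷ (w 1 , q) ∷ [])))
    ×
    -- (iii)
    (∀ j → 2 ≤ j → j < m → w m < u → w j < y → y ≤ w (j ∸ 1) →
      ((u , p) ∷ un y ∷ (w m , q) ∷ seg w 1 (m ∸ 1))
        ∼dec ((un u ∷ (w m , q) ∷ seg w (suc j) (m ∸ 1))
               ++ (un y ∷ seg w 1 (j ∸ 1) ++ ((w j , p) ∷ []))))
    ×
    -- (iv)
    (∀ j → 2 ≤ j → j < m → u ≤ w m → w j < y → y ≤ w (j ∸ 1) →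
      ((u , p) ∷ un y ∷ (w m , q) ∷ seg w 1 (m ∸ 1))
        ∼dec (((u , p) ∷ seg w (suc j) m)
               ++ (un y ∷ seg w 1 (j ∸ 1) ++ ((w j , q) ∷ []))))
    ×
    -- (v)
    (2 ≤ m → y ≤ w (m ∸ 1) →
      ((u , p) ∷ un y ∷ (w m , q) ∷ seg w 1 (m ∸ 1))
        ∼dec ((u , p) ∷ un y ∷ seg w 1 (m ∸ 1) ++ ((w m , q) ∷ [])))
mainTheorem16 m w y u p q 1≤m mono pos _ wm<y 1≤u u≤y =
    (λ 1<m wm<u w1<y → swap-settle w m 1 ≤-refl 1<m mono 1≤wm wm<u u≤y w1<y (λ { (s≤s ()) }))
  , (λ _ u≤wm w1<y → settle w m 1 ≤-refl 1≤m mono w1<y (λ { (s≤s ()) }) 1≤u u≤wm)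
  , (λ j 2≤j j<m wm<u wj<y y≤ →
       swap-settle w m j (1≤j 2≤j) j<m mono 1≤wm wm<u u≤y wj<y (λ _ → y≤))
  , (λ j 2≤j j<m u≤wm wj<y y≤ →
       settle w m j (1≤j 2≤j) (<⇒≤ j<m) mono wj<y (λ _ → y≤) 1≤u u≤wm)
  , (λ _ y≤ → sink w (m ∸ 1) 1≤u u≤y 1≤wm wm<y (λ _ → y≤)
                   (AntitoneOn-restrict w mono ≤-refl (m∸n≤m m 1)))
  where
    1≤wm : 1 ≤ w m
    1≤wm = pos m 1≤m ≤-refl
    1≤j : ∀ {j} → 2 ≤ j → 1 ≤ j
    1≤j = ≤-trans (n≤1+n 1)
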